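{- Let $R$ be a Dedekind domain and let $I = \mathfrak{m}_1^{a_1} \mathfrak{m}_2^{a_2} \cdots \mathfrak{m}_r^{a_r}$ be a nonzero proper ideal of $R$, where $\mathfrak{m}_1, \dots, \mathfrak{m}_r$ are distinct maximal ideals of $R$ and $a_i \geq 1$. Let $A = R/I$. Then the unitary Cayley graph $\mathrm{Cay}(A; A^*)$ is a conjunction $G_1 \wedge \cdots \wedge G_r$ where each $G_i$ is a complete $k_i$-partite graph with $k_i = \#(R/\mathfrak{m}_i)$.
   Context: A Dedekind domain is a Noetherian integrally closed integral domain in which every nonzero prime ideal is maximal. For a commutative ring $A$ with group of units $A^*$, the unitary Cayley graph $\mathrm{Cay}(A; A^*)$ has vertex set $A$, with $x, y$ adjacent iff $x - y \in A^*$. A complete $k$-partite graph is a graph whose vertex set is partitioned into $k$ nonempty parts (here $k$ may be an infinite cardinal), two vertices being adjacent iff they lie in different parts. The conjunction $G_1 \wedge G_2$ of graphs has vertex set $V(G_1) \times V(G_2)$, with $(v_1,v_2)$ adjacent to $(u_1,u_2)$ iff $v_1u_1 \in E(G_1)$ and $v_2u_2 \in E(G_2)$; iterated conjunctions are defined analogously (up to graph isomorphism). -}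

module Defs where

open import Level using (Level; _⊔_; suc)
open import Algebra.Bundles using (CommutativeRing)
open import Relation.Binary.Bundles using (Setoid)
open import Data.Nat using (ℕ; zero; _≤_; _≥_)
import Data.Nat as ℕ
open import Data.Fin using (Fin)
import Data.Fin as Fin
open import Data.Vec using (Vec; []; _∷_)
open import Data.List using (List; []; _∷_)
open import Data.Product using (Σ; ∃; _×_; _,_)
open import Data.Unit using (⊤)
open import Level using (Lift)
open import Data.Sum using (_⊎_)
open import Relation.Nullary using (¬_)
open import Function.Bundles using (_⇔_)

record Graph (a b e : Level) : Set (suc (a ⊔ b ⊔ e)) where
  field
    V   : Setoid a b
  open Setoid V public using (Carrier; _≈_)
  field
    Adj     : Carrier → Carrier → Set e

record _≅G_ {a b e a′ b′ e′} (G : Graph a b e) (H : Graph a′ b′ e′)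
       : Set (a ⊔ b ⊔ e ⊔ a′ ⊔ b′ ⊔ e′) where
  private
    module G = Graph G
    module H = Graph H
  field
    to       : G.Carrier → H.Carrier
    from     : H.Carrier → G.Carrier
    to-cong  : ∀ {x y} → x G.≈ y → to x H.≈ to y
    from-cong : ∀ {x y} → x H.≈ y → from x G.≈ from y
    to-from  : ∀ y → to (from y) H.≈ y
    from-to  : ∀ x → from (to x) G.≈ x
    adj      : ∀ x y → G.Adj x y ⇔ H.Adj (to x) (to y)

ConjSetoid : ∀ {a b e} {r : ℕ} → (Fin r → Graph a b e) → Setoid a b
ConjSetoid {r = r} G = record
  { Carrier = (i : Fin r) → Graph.Carrier (G i)
  ; _≈_ = λ x y → ∀ i → Graph._≈_ (G i) (x i) (y i)
  ; isEquivalence = record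
    { refl = λ {x} i → Setoid.refl (Graph.V (G i))
    ; sym = λ p i → Setoid.sym (Graph.V (G i)) (p i)
    ; trans = λ p q i → Setoid.trans (Graph.V (G i)) (p i) (q i)
    }
  }

Conj : ∀ {a b e} {r : ℕ} → (Fin r → Graph a b e) → Graph a b e
Conj {r = r} G = record
  { V = ConjSetoid G
  ; Adj = λ x y → ∀ i → Graph.Adj (G i) (x i) (y i)
  }

-- G is a complete multipartite graph whose set of parts is (in bijection
-- with) the setoid S: there is a part-assignment map V → S, respecting
-- equality, which is surjective (every part nonempty), and two vertices
-- are adjacent iff they lie in different parts.  Thus G is complete
-- k-partite with k = #S.
record IsCompleteMultipartiteOver {a b e s t} (G : Graph a b e) (S : Setoid s t)
       : Set (a ⊔ b ⊔ e ⊔ s ⊔ t) where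
  private
    module G = Graph G
    module S = Setoid S
  field
    part      : G.Carrier → S.Carrier
    part-cong : ∀ {x y} → x G.≈ y → part x S.≈ part y
    part-surj : ∀ (p : S.Carrier) → ∃ λ x → part x S.≈ p
    adj       : ∀ x y → G.Adj x y ⇔ (¬ (part x S.≈ part y))

module _ {c ℓ} (R : CommutativeRing c ℓ) where
  open CommutativeRing R

  infixl 6 _−_
  _−_ : Carrier → Carrier → Carrier
  x − y = x + (- y)

  pow : Carrier → ℕ → Carrier
  pow x zero = 1#
  pow x (ℕ.suc n) = x * pow x n

  record Ideal : Set (suc (c ⊔ ℓ)) where
    field
      _∈I      : Carrier → Set (c ⊔ ℓ)
      ∈-resp   : ∀ {x y} → x ≈ y → x ∈I → y ∈I
      0∈       : 0# ∈I
      +-closed : ∀ {x y} → x ∈I → y ∈I → (x + y) ∈I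
      *-closed : ∀ r {x} → x ∈I → (r * x) ∈I

  infix 4 _∈_ _⊆_ _≐_
  _∈_ : Carrier → Ideal → Set (c ⊔ ℓ)
  x ∈ I = Ideal._∈I I x

  _⊆_ : Ideal → Ideal → Set (c ⊔ ℓ)
  I ⊆ J = ∀ {x} → x ∈ I → x ∈ J

  _≐_ : Ideal → Ideal → Set (c ⊔ ℓ)
  I ≐ J = (I ⊆ J) × (J ⊆ I)

  Proper : Ideal → Set (c ⊔ ℓ)
  Proper I = ¬ (1# ∈ I)

  Nonzero : Ideal → Set (c ⊔ ℓ)
  Nonzero I = ∃ λ x → (x ∈ I) × (¬ (x ≈ 0#))

  IsPrime : Ideal → Set (c ⊔ ℓ)
  IsPrime P = Proper P × (∀ x y → (x * y) ∈ P → (x ∈ P) ⊎ (y ∈ P))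

  IsMaximal : Ideal → Set (suc (c ⊔ ℓ))
  IsMaximal m = Proper m × (∀ (J : Ideal) → m ⊆ J → (J ⊆ m) ⊎ (1# ∈ J))

  WholeIdeal : Ideal
  WholeIdeal = record
    { _∈I = λ _ → Lift (c ⊔ ℓ) ⊤
    ; ∈-resp = λ _ p → p ; 0∈ = _ ; +-closed = λ _ _ → _ ; *-closed = λ _ _ → _ }

  sumProd : List (Carrier × Carrier) → Carrier
  sumProd [] = 0#
  sumProd ((x , y) ∷ ps) = x * y + sumProd ps

  data AllIn (I J : Ideal) : List (Carrier × Carrier) → Set (c ⊔ ℓ) where
    []  : AllIn I J []
    _∷_ : ∀ {x y ps} → (x ∈ I) × (y ∈ J) → AllIn I J ps → AllIn I J ((x , y) ∷ ps)

  _·_ : Ideal → Ideal → Ideal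
  I · J = record
    { _∈I = λ z → ∃ λ ps → AllIn I J ps × (z ≈ sumProd ps)
    ; ∈-resp = λ { e (ps , a , q) → ps , a , trans (sym e) q }
    ; 0∈ = [] , [] , refl
    ; +-closed = λ { (ps , a , p) (qs , b , q) →
        appendP ps qs , appendA a b , trans (+-cong p q) (sumApp ps qs) }
    ; *-closed = λ { r (ps , a , p) →
        scaleP r ps , scaleA r a , trans (*-cong refl p) (sumScale r ps) }
    }
    where
    appendP : List (Carrier × Carrier) → List (Carrier × Carrier) → List (Carrier × Carrier)
    appendP [] qs = qs
    appendP (p ∷ ps) qs = p ∷ appendP ps qs
    appendA : ∀ {ps qs} → AllIn I J ps → AllIn I J qs → AllIn I J (appendP ps qs)
    appendA [] b = b
    appendA (h ∷ a) b = h ∷ appendA a b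
    sumApp : ∀ ps qs → sumProd ps + sumProd qs ≈ sumProd (appendP ps qs)
    sumApp [] qs = +-identityˡ (sumProd qs)
    sumApp ((x , y) ∷ ps) qs =
      trans (+-assoc (x * y) (sumProd ps) (sumProd qs)) (+-cong refl (sumApp ps qs))
    scaleP : Carrier → List (Carrier × Carrier) → List (Carrier × Carrier)
    scaleP r [] = []
    scaleP r ((x , y) ∷ ps) = (r * x , y) ∷ scaleP r ps
    scaleA : ∀ r {ps} → AllIn I J ps → AllIn I J (scaleP r ps)
    scaleA r [] = []
    scaleA r ((hx , hy) ∷ a) = (Ideal.*-closed I r hx , hy) ∷ scaleA r a
    sumScale : ∀ r ps → r * sumProd ps ≈ sumProd (scaleP r ps)
    sumScale r [] = zeroʳ r
    sumScale r ((x , y) ∷ ps) =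
      trans (distribˡ r (x * y) (sumProd ps))
            (+-cong (sym (*-assoc r x y)) (sumScale r ps))

  _^I_ : Ideal → ℕ → Ideal
  m ^I zero = WholeIdeal
  m ^I ℕ.suc n = m · (m ^I n)

  ProdIdeals : ∀ {r} → (Fin r → Ideal) → Ideal
  ProdIdeals {zero} I = WholeIdeal
  ProdIdeals {ℕ.suc r} I = I Fin.zero · ProdIdeals (λ i → I (Fin.suc i))

  IsIntegralDomain : Set (c ⊔ ℓ)
  IsIntegralDomain = (¬ (1# ≈ 0#)) × (∀ x y → x * y ≈ 0# → (x ≈ 0#) ⊎ (y ≈ 0#))

  IsNoetherian : Set (suc (c ⊔ ℓ))
  IsNoetherian = ∀ (C : ℕ → Ideal) → (∀ n → C n ⊆ C (ℕ.suc n)) →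
                 ∃ λ N → ∀ n → N ≤ n → C n ⊆ C N

  clearedSum : ∀ {n} → Carrier → Carrier → Vec Carrier n → Carrier
  clearedSum {n} a b cs = go 0 cs
    where
    go : ∀ {k} → ℕ → Vec Carrier k → Carrier
    go i [] = 0#
    go i (ci ∷ cs′) = ci * pow a i * pow b (n ℕ.∸ i) + go (ℕ.suc i) cs′

  -- Integrally closed (in the field of fractions): if a/b (b ≠ 0) is a root
  -- of a monic polynomial Xⁿ + c_{n-1}X^{n-1} + ⋯ + c₀ over R, i.e. (after
  -- multiplying by bⁿ) aⁿ + Σ_{i<n} cᵢ aⁱ b^{n-i} = 0, then a/b ∈ R,
  -- i.e. a = r b for some r ∈ R.
  IsIntegrallyClosed : Set (c ⊔ ℓ)
  IsIntegrallyClosed =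
    ∀ (a b : Carrier) → ¬ (b ≈ 0#) → ∀ (n : ℕ) (cs : Vec Carrier n) →
    pow a n + clearedSum a b cs ≈ 0# → ∃ λ r → a ≈ r * b

  IsDedekindDomain : Set (suc (c ⊔ ℓ))
  IsDedekindDomain =
    IsIntegralDomain × IsNoetherian × IsIntegrallyClosed ×
    (∀ (P : Ideal) → Nonzero P → IsPrime P → IsMaximal P)

  private
    module Alg where
      open import Relation.Binary.Reasoning.Setoid setoid
      open import Algebra.Properties.Ring ring using (-1*x≈-x; -‿involutive)
      open import Algebra.Properties.AbelianGroup +-abelianGroup using (⁻¹-∙-comm)
      negSub : ∀ x y → (- 1#) * (x − y) ≈ y − x
      negSub x y = begin
        (- 1#) * (x − y)     ≈⟨ -1*x≈-x (x − y) ⟩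
        - (x + - y)          ≈⟨ sym (⁻¹-∙-comm x (- y)) ⟩
        - x + - - y          ≈⟨ +-comm (- x) (- - y) ⟩
        - - y + - x          ≈⟨ +-cong (-‿involutive y) refl ⟩
        y − x                ∎
      addSub : ∀ x y z → (x − y) + (y − z) ≈ x − z
      addSub x y z = begin
        (x + - y) + (y + - z)   ≈⟨ +-assoc x (- y) (y + - z) ⟩
        x + (- y + (y + - z))   ≈⟨ +-cong refl (sym (+-assoc (- y) y (- z))) ⟩
        x + ((- y + y) + - z)   ≈⟨ +-cong refl (+-cong (-‿inverseˡ y) refl) ⟩
        x + (0# + - z)          ≈⟨ +-cong refl (+-identityˡ (- z)) ⟩
        x − z                   ∎

  Quot : Ideal → Setoid c (c ⊔ ℓ)
  Quot I = record
    { Carrier = Carrier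
    ; _≈_ = λ x y → (x − y) ∈ I
    ; isEquivalence = record
      { refl = λ {x} → Ideal.∈-resp I (sym (-‿inverseʳ x)) (Ideal.0∈ I)
      ; sym = λ {x} {y} p → Ideal.∈-resp I (Alg.negSub x y) (Ideal.*-closed I (- 1#) p)
      ; trans = λ {x} {y} {z} p q → Ideal.∈-resp I (Alg.addSub x y z) (Ideal.+-closed I p q)
      }
    }

  IsUnitMod : Ideal → Carrier → Set (c ⊔ ℓ)
  IsUnitMod I x = ∃ λ y → (x * y − 1#) ∈ I

  UnitaryCayley : Ideal → Graph c (c ⊔ ℓ) (c ⊔ ℓ)
  UnitaryCayley I = record
    { V = Quot I
    ; Adj = λ x y → IsUnitMod I (x − y)
    }

-- For I = m₁^a₁ ⋯ m_r^a_r the ideals m_i^a_i are pairwise comaximal, so the Chinese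
-- remainder theorem identifies R/I with ∏ R/m_i^a_i; since units of a product are
-- the tuples of units, this is a graph isomorphism Cay(R/I) ≅ ∧ Cay(R/m_i^a_i).
-- In the local ring R/m^a (a ≥ 1) an element is a unit iff it lies outside m/m^a,
-- so x, y are adjacent iff x ≢ y (mod m): Cay(R/m^a) is complete multipartite
-- with parts the classes of R/m.  Maximality of the m_i is all that is used.
module Submission where

open import Level using (_⊔_)
open import Algebra.Bundles using (CommutativeRing)
open import Data.Nat using (ℕ; zero; suc; _≤_)
open import Data.Fin using (Fin)
import Data.Fin as Fin
open import Data.Fin.Properties using (suc-injective)
open import Data.Product using (∃; _×_; _,_; proj₁; proj₂)
open import Data.Sum using (inj₁; inj₂)
open import Data.Empty using (⊥-elim)
open import Data.List using ([]; _∷_)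
open import Data.Maybe using (nothing)
open import Function.Bundles using (_⇔_; mk⇔)
open import Relation.Binary.Bundles using (Setoid)
open import Relation.Nullary using (¬_)
open import Relation.Binary.PropositionalEquality using (_≢_)
import Tactic.RingSolver.Core.AlmostCommutativeRing as ACR

open import Defs hiding (_∈_; _⊆_; _−_; _·_)

module CommutativeAlgebra {c ℓ} (R : CommutativeRing c ℓ) where
  open CommutativeRing R
  open import Relation.Binary.Reasoning.Setoid setoid
  open import Algebra.Properties.Ring ring using (x[y-z]≈xy-xz; -0#≈0#)
  open import Algebra.Properties.CommutativeSemigroup +-commutativeSemigroup
    using (interchange)
  open import Algebra.Properties.AbelianGroup +-abelianGroup using (xyx⁻¹≈y)
  open import Tactic.RingSolver.NonReflective (ACR.fromCommutativeRing R (λ _ → nothing))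

  infix  4 _∈_ _⊆_ _≡_mod_
  infixl 7 _·_
  infixl 6 _+ᴵ_
  infixr 8 _^_

  _∈_ : Carrier → Ideal R → Set (c ⊔ ℓ)
  _∈_ = Defs._∈_ R

  _⊆_ : Ideal R → Ideal R → Set (c ⊔ ℓ)
  _⊆_ = Defs._⊆_ R

  _·_ : Ideal R → Ideal R → Ideal R
  _·_ = Defs._·_ R

  _^_ : Ideal R → ℕ → Ideal R
  _^_ = _^I_ R

  _≡_mod_ : Carrier → Carrier → Ideal R → Set (c ⊔ ℓ)
  x ≡ y mod I = x - y ∈ I

  module Mod (I : Ideal R) = Setoid (Quot R I)

  *-closedʳ : ∀ (I : Ideal R) r {x} → x ∈ I → x * r ∈ I
  *-closedʳ I r {x} x∈I = Ideal.∈-resp I (*-comm r x) (Ideal.*-closed I r x∈I)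

  ∈⇒≡0 : ∀ (I : Ideal R) {x} → x ∈ I → x ≡ 0# mod I
  ∈⇒≡0 I {x} = Ideal.∈-resp I (sym (trans (+-cong refl -0#≈0#) (+-identityʳ x)))

  ≡0⇒∈ : ∀ (I : Ideal R) {x} → x ≡ 0# mod I → x ∈ I
  ≡0⇒∈ I {x} = Ideal.∈-resp I (trans (+-cong refl -0#≈0#) (+-identityʳ x))

  *-congˡ-mod : ∀ (I : Ideal R) r {x y} → x ≡ y mod I → r * x ≡ r * y mod I
  *-congˡ-mod I r {x} {y} p = Ideal.∈-resp I (x[y-z]≈xy-xz r x y) (Ideal.*-closed I r p)

  x≈y+z⇒x-y≈z : ∀ {x y z} → x ≈ y + z → x - y ≈ z
  x≈y+z⇒x-y≈z {x} {y} {z} x≈y+z = trans (+-cong x≈y+z refl) (xyx⁻¹≈y y z)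

  ≈+∈⇒≡ : ∀ (I : Ideal R) {x y z} → x ≈ y + z → z ∈ I → x ≡ y mod I
  ≈+∈⇒≡ I x≈y+z = Ideal.∈-resp I (sym (x≈y+z⇒x-y≈z x≈y+z))

  ·-⊆ˡ : ∀ (A B : Ideal R) → A · B ⊆ A
  ·-⊆ˡ A B (ps , ps∈ , x≈) = Ideal.∈-resp A (sym x≈) (sum∈A ps∈)
    where
    sum∈A : ∀ {ps} → AllIn R A B ps → sumProd R ps ∈ A
    sum∈A [] = Ideal.0∈ A
    sum∈A ((x∈A , _) ∷ rest) = Ideal.+-closed A (*-closedʳ A _ x∈A) (sum∈A rest)

  ·-⊆ʳ : ∀ (A B : Ideal R) → A · B ⊆ B
  ·-⊆ʳ A B (ps , ps∈ , x≈) = Ideal.∈-resp B (sym x≈) (sum∈B ps∈)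
    where
    sum∈B : ∀ {ps} → AllIn R A B ps → sumProd R ps ∈ B
    sum∈B [] = Ideal.0∈ B
    sum∈B ((_ , y∈B) ∷ rest) = Ideal.+-closed B (Ideal.*-closed B _ y∈B) (sum∈B rest)

  *-∈-· : ∀ (A B : Ideal R) {x y} → x ∈ A → y ∈ B → x * y ∈ A · B
  *-∈-· A B {x} {y} x∈A y∈B = (x , y) ∷ [] , (x∈A , y∈B) ∷ [] , sym (+-identityʳ (x * y))

  ^-⊆ : ∀ (m : Ideal R) n → 1 ≤ n → m ^ n ⊆ m
  ^-⊆ m (suc n) _ = ·-⊆ˡ m (m ^ n)

  _+ᴵ_ : Ideal R → Ideal R → Ideal R
  A +ᴵ B = record
    { _∈I      = λ w → ∃ λ x → ∃ λ y → x ∈ A × y ∈ B × w ≈ x + y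
    ; ∈-resp   = λ { w≈w′ (x , y , x∈ , y∈ , w≈) → x , y , x∈ , y∈ , trans (sym w≈w′) w≈ }
    ; 0∈       = 0# , 0# , Ideal.0∈ A , Ideal.0∈ B , sym (+-identityˡ 0#)
    ; +-closed = λ { (x , y , x∈ , y∈ , w≈) (x′ , y′ , x′∈ , y′∈ , w′≈) →
        x + x′ , y + y′ , Ideal.+-closed A x∈ x′∈ , Ideal.+-closed B y∈ y′∈ ,
        trans (+-cong w≈ w′≈) (interchange x y x′ y′) }
    ; *-closed = λ { r (x , y , x∈ , y∈ , w≈) →
        r * x , r * y , Ideal.*-closed A r x∈ , Ideal.*-closed B r y∈ ,
        trans (*-cong refl w≈) (distribˡ r x y) }
    }

  ⟨_⟩ : Carrier → Ideal R
  ⟨ z ⟩ = record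
    { _∈I      = λ w → ∃ λ s → w ≈ s * z
    ; ∈-resp   = λ { w≈w′ (s , w≈) → s , trans (sym w≈w′) w≈ }
    ; 0∈       = 0# , sym (zeroˡ z)
    ; +-closed = λ { (s , w≈) (s′ , w′≈) → s + s′ , trans (+-cong w≈ w′≈) (sym (distribʳ z s s′)) }
    ; *-closed = λ { r (s , w≈) → r * s , trans (*-cong refl w≈) (sym (*-assoc r s z)) }
    }

  z∈⟨z⟩ : ∀ z → z ∈ ⟨ z ⟩
  z∈⟨z⟩ z = 1# , sym (*-identityˡ z)

  record Comaximal (A B : Ideal R) : Set (c ⊔ ℓ) where
    constructor comaximal
    field
      u v   : Carrier
      u∈A   : u ∈ A
      v∈B   : v ∈ B
      u+v≈1 : u + v ≈ 1#

  comaximal-sym : ∀ {A B} → Comaximal A B → Comaximal B A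
  comaximal-sym (comaximal u v u∈A v∈B u+v≈1) =
    comaximal v u v∈B u∈A (trans (+-comm v u) u+v≈1)

  comaximal-whole : ∀ A → Comaximal A (WholeIdeal R)
  comaximal-whole A = comaximal 0# 1# (Ideal.0∈ A) _ (+-identityˡ 1#)

  comaximal-· : ∀ {A B C} → Comaximal A B → Comaximal A C → Comaximal A (B · C)
  comaximal-· {A} {B} {C} (comaximal u v u∈A v∈B u+v≈1) (comaximal u′ v′ u′∈A v′∈C u′+v′≈1) =
    comaximal (u * (u′ + v′) + v * u′) (v * v′)
      (Ideal.+-closed A (*-closedʳ A _ u∈A) (Ideal.*-closed A v u′∈A))
      (*-∈-· B C v∈B v′∈C)
      (begin
        u * (u′ + v′) + v * u′ + v * v′  ≈⟨ solve 4 (λ u v u′ v′ →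
                                               (u ⊗ (u′ ⊕ v′) ⊕ v ⊗ u′ ⊕ v ⊗ v′)
                                                 ⊜ ((u ⊕ v) ⊗ (u′ ⊕ v′)))
                                               refl u v u′ v′ ⟩
        (u + v) * (u′ + v′)              ≈⟨ *-cong u+v≈1 u′+v′≈1 ⟩
        1# * 1#                          ≈⟨ *-identityˡ 1# ⟩
        1#                               ∎)

  comaximal-^ : ∀ {A B} → Comaximal A B → ∀ n → Comaximal (A ^ n) B
  comaximal-^ {A} {B} A+B≈R zero    = comaximal-sym (comaximal-whole B)
  comaximal-^ {A} {B} A+B≈R (suc n) =
    comaximal-sym (comaximal-· (comaximal-sym A+B≈R) (comaximal-sym (comaximal-^ A+B≈R n)))

  comaximal-^-^ : ∀ {A B} → Comaximal A B → ∀ p q → Comaximal (A ^ p) (B ^ q)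
  comaximal-^-^ A+B≈R p q =
    comaximal-^ (comaximal-sym (comaximal-^ (comaximal-sym A+B≈R) q)) p

  comaximal-∩⊆· : ∀ {A B} → Comaximal A B → ∀ {x} → x ∈ A → x ∈ B → x ∈ A · B
  comaximal-∩⊆· {A} {B} (comaximal u v u∈A v∈B u+v≈1) {x} x∈A x∈B =
    Ideal.∈-resp (A · B) ux+xv≈x
      (Ideal.+-closed (A · B) (*-∈-· A B u∈A x∈B) (*-∈-· A B x∈A v∈B))
    where
    ux+xv≈x : u * x + x * v ≈ x
    ux+xv≈x = begin
      u * x + x * v  ≈⟨ solve 3 (λ u v x → (u ⊗ x ⊕ x ⊗ v) ⊜ (x ⊗ (u ⊕ v))) refl u v x ⟩
      x * (u + v)    ≈⟨ *-cong refl u+v≈1 ⟩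
      x * 1#         ≈⟨ *-identityʳ x ⟩
      x              ∎

  comaximal-crt : ∀ {A B} → Comaximal A B → ∀ f g →
                  ∃ λ x → x ≡ f mod A × x ≡ g mod B
  comaximal-crt {A} {B} (comaximal u v u∈A v∈B u+v≈1) f g =
    u * g + v * f
    , Mod.trans A (≈+∈⇒≡ A (+-comm (u * g) (v * f)) (*-closedʳ A g u∈A))
                  (Mod.sym A (≈+∈⇒≡ A (split f) (*-closedʳ A f u∈A)))
    , Mod.trans B (≈+∈⇒≡ B refl (*-closedʳ B f v∈B))
                  (Mod.sym B (≈+∈⇒≡ B (trans (split g) (+-comm (v * g) (u * g)))
                                      (*-closedʳ B g v∈B)))
    where
    split : ∀ y → y ≈ v * y + u * y
    split y = begin
      y              ≈⟨ *-identityˡ y ⟨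
      1# * y         ≈⟨ *-cong (trans (sym u+v≈1) (+-comm u v)) refl ⟩
      (v + u) * y    ≈⟨ distribʳ y v u ⟩
      v * y + u * y  ∎

  maximal⇒comaximal : ∀ {m B} → IsMaximal R m → ¬ (B ⊆ m) → Comaximal m B
  maximal⇒comaximal {m} {B} (_ , maximal) B⊈m
    with maximal (m +ᴵ B) (λ {x} x∈m → x , 0# , x∈m , Ideal.0∈ B , sym (+-identityʳ x))
  ... | inj₁ m+B⊆m = ⊥-elim (B⊈m (λ {y} y∈B →
          m+B⊆m (0# , y , Ideal.0∈ m , y∈B , sym (+-identityˡ y))))
  ... | inj₂ (u , v , u∈m , v∈B , 1≈u+v) = comaximal u v u∈m v∈B (sym 1≈u+v)

  distinct-maximal⇒comaximal : ∀ {m₁ m₂} → IsMaximal R m₁ → IsMaximal R m₂ →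
                               ¬ (_≐_ R m₁ m₂) → Comaximal m₁ m₂
  distinct-maximal⇒comaximal {m₁} {m₂} m₁-max (m₂-proper , m₂-maximal) m₁≉m₂ =
    maximal⇒comaximal m₁-max m₂⊈m₁
    where
    m₂⊈m₁ : ¬ (m₂ ⊆ m₁)
    m₂⊈m₁ m₂⊆m₁ with m₂-maximal m₁ m₂⊆m₁
    ... | inj₁ m₁⊆m₂ = m₁≉m₂ (m₁⊆m₂ , m₂⊆m₁)
    ... | inj₂ 1∈m₁  = proj₁ m₁-max 1∈m₁

  comaximal-⟨⟩⇒unit : ∀ {J z} → Comaximal J ⟨ z ⟩ → IsUnitMod R J z
  comaximal-⟨⟩⇒unit {J} {z} (comaximal u v u∈J (s , v≈sz) u+v≈1) =
    s , Mod.sym J (Ideal.∈-resp J (sym 1-zs≈u) u∈J)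
    where
    1-zs≈u : 1# - z * s ≈ u
    1-zs≈u = x≈y+z⇒x-y≈z (begin
      1#         ≈⟨ sym u+v≈1 ⟩
      u + v      ≈⟨ +-comm u v ⟩
      v + u      ≈⟨ +-cong (trans v≈sz (*-comm s z)) refl ⟩
      z * s + u  ∎)

  unit-mod-^ : ∀ {m} → IsMaximal R m → ∀ n {z} → ¬ (z ∈ m) → IsUnitMod R (m ^ n) z
  unit-mod-^ {m} m-max n {z} z∉m =
    comaximal-⟨⟩⇒unit (comaximal-^ (maximal⇒comaximal m-max ⟨z⟩⊈m) n)
    where
    ⟨z⟩⊈m : ¬ (⟨ z ⟩ ⊆ m)
    ⟨z⟩⊈m ⟨z⟩⊆m = z∉m (⟨z⟩⊆m (z∈⟨z⟩ z))

  ∈-proper⇒¬unit : ∀ {m J z} → Proper R m → J ⊆ m → z ∈ m → ¬ IsUnitMod R J z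
  ∈-proper⇒¬unit {m} {J} {z} m-proper J⊆m z∈m (w , zw≡1) =
    m-proper (≡0⇒∈ m (Mod.trans m (Mod.sym m (J⊆m zw≡1)) (∈⇒≡0 m (*-closedʳ m w z∈m))))

  IsUnitMod-mono : ∀ {I J z} → I ⊆ J → IsUnitMod R I z → IsUnitMod R J z
  IsUnitMod-mono I⊆J (w , zw≡1) = w , I⊆J zw≡1

  PairwiseComaximal : ∀ {r} → (Fin r → Ideal R) → Set (c ⊔ ℓ)
  PairwiseComaximal J = ∀ i j → i ≢ j → Comaximal (J i) (J j)

  comaximal-Prod : ∀ {r A} (J : Fin r → Ideal R) → (∀ i → Comaximal A (J i)) →
                   Comaximal A (ProdIdeals R J)
  comaximal-Prod {zero}  {A} J h = comaximal-whole A
  comaximal-Prod {suc r}     J h =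
    comaximal-· (h Fin.zero) (comaximal-Prod (λ i → J (Fin.suc i)) (λ i → h (Fin.suc i)))

  Prod-⊆ : ∀ {r} (J : Fin r → Ideal R) i → ProdIdeals R J ⊆ J i
  Prod-⊆ J Fin.zero    = ·-⊆ˡ (J Fin.zero) _
  Prod-⊆ J (Fin.suc i) x∈Prod = Prod-⊆ (λ k → J (Fin.suc k)) i (·-⊆ʳ (J Fin.zero) _ x∈Prod)

  module _ {r} (J : Fin (suc r) → Ideal R) (pw : PairwiseComaximal J) where

    pairwiseComaximal-suc : PairwiseComaximal (λ i → J (Fin.suc i))
    pairwiseComaximal-suc i j i≢j = pw (Fin.suc i) (Fin.suc j) (λ si≡sj → i≢j (suc-injective si≡sj))

    comaximal-head-Prod : Comaximal (J Fin.zero) (ProdIdeals R (λ i → J (Fin.suc i)))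
    comaximal-head-Prod =
      comaximal-Prod (λ i → J (Fin.suc i)) (λ i → pw Fin.zero (Fin.suc i) (λ ()))

  ⋂⊆Prod : ∀ {r} (J : Fin r → Ideal R) → PairwiseComaximal J →
           ∀ {x} → (∀ i → x ∈ J i) → x ∈ ProdIdeals R J
  ⋂⊆Prod {zero}  J pw x∈J = _
  ⋂⊆Prod {suc r} J pw x∈J =
    comaximal-∩⊆· (comaximal-head-Prod J pw) (x∈J Fin.zero)
      (⋂⊆Prod (λ i → J (Fin.suc i)) (pairwiseComaximal-suc J pw) (λ i → x∈J (Fin.suc i)))

  chineseRemainder : ∀ {r} (J : Fin r → Ideal R) → PairwiseComaximal J →
                     (f : Fin r → Carrier) → ∃ λ x → ∀ i → x ≡ f i mod J i
  chineseRemainder {zero}  J pw f = 0# , λ ()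
  chineseRemainder {suc r} J pw f
    with chineseRemainder (λ i → J (Fin.suc i)) (pairwiseComaximal-suc J pw) (λ i → f (Fin.suc i))
  ... | y , y≡f-tail
    with comaximal-crt (comaximal-head-Prod J pw) (f Fin.zero) y
  ... | x , x≡f₀ , x≡y = x , x≡f
    where
    x≡f : ∀ i → x ≡ f i mod J i
    x≡f Fin.zero    = x≡f₀
    x≡f (Fin.suc i) = Mod.trans (J (Fin.suc i)) (Prod-⊆ (λ k → J (Fin.suc k)) i x≡y) (y≡f-tail i)

  unitaryCayley-^-completeMultipartite :
    ∀ {m} → IsMaximal R m → ∀ n → 1 ≤ n →
    IsCompleteMultipartiteOver (UnitaryCayley R (m ^ n)) (Quot R m)
  unitaryCayley-^-completeMultipartite {m} m-max n 1≤n = record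
    { part      = λ x → x
    ; part-cong = mⁿ⊆m
    ; part-surj = λ p → p , Mod.refl m
    ; adj       = unit⇔∉m
    }
    where
    mⁿ⊆m : m ^ n ⊆ m
    mⁿ⊆m = ^-⊆ m n 1≤n

    unit⇔∉m : ∀ x y → IsUnitMod R (m ^ n) (x - y) ⇔ (¬ (x - y ∈ m))
    unit⇔∉m x y =
      mk⇔ (λ unit x-y∈m → ∈-proper⇒¬unit {m} {m ^ n} {x - y} (proj₁ m-max) mⁿ⊆m x-y∈m unit)
          (unit-mod-^ {m} m-max n {x - y})

  unitaryCayley≅Conj : ∀ {r} (I : Ideal R) (J : Fin r → Ideal R) → PairwiseComaximal J →
                       _≐_ R I (ProdIdeals R J) →
                       UnitaryCayley R I ≅G Conj (λ i → UnitaryCayley R (J i))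
  unitaryCayley≅Conj I J pw (I⊆ΠJ , ΠJ⊆I) = record
    { to        = λ x i → x
    ; from      = λ f → proj₁ (crt f)
    ; to-cong   = λ x≡y i → I⊆J i x≡y
    ; from-cong = λ {f} {g} f≡g → ≡-all⇒≡ (λ i →
        Mod.trans (J i) (proj₂ (crt f) i)
                        (Mod.trans (J i) (f≡g i) (Mod.sym (J i) (proj₂ (crt g) i))))
    ; to-from   = λ f → proj₂ (crt f)
    ; from-to   = λ x → ≡-all⇒≡ (proj₂ (crt (λ _ → x)))
    ; adj       = λ x y →
        mk⇔ (λ unit i → IsUnitMod-mono {I} {J i} {x - y} (I⊆J i) unit) (unit-all⇒unit {x - y})
    }
    where
    crt : (f : Fin _ → Carrier) → ∃ λ x → ∀ i → x ≡ f i mod J i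
    crt = chineseRemainder J pw

    I⊆J : ∀ i → I ⊆ J i
    I⊆J i x∈I = Prod-⊆ J i (I⊆ΠJ x∈I)

    ≡-all⇒≡ : ∀ {x y} → (∀ i → x ≡ y mod J i) → x ≡ y mod I
    ≡-all⇒≡ x≡y = ΠJ⊆I (⋂⊆Prod J pw x≡y)

    unit-all⇒unit : ∀ {z} → (∀ i → IsUnitMod R (J i) z) → IsUnitMod R I z
    unit-all⇒unit {z} unit with crt (λ i → proj₁ (unit i))
    ... | w , w≡wᵢ = w , ≡-all⇒≡ (λ i →
          Mod.trans (J i) (*-congˡ-mod (J i) z (w≡wᵢ i)) (proj₂ (unit i)))

corollary4p7 : ∀ {c ℓ} (R : CommutativeRing c ℓ) → IsDedekindDomain R →
    (I : Ideal R) → Nonzero R I → Proper R I →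
    (r : ℕ) (m : Fin r → Ideal R) (a : Fin r → ℕ) →
    (∀ i → IsMaximal R (m i)) →
    (∀ i j → i ≢ j → ¬ (_≐_ R (m i) (m j))) →
    (∀ i → 1 ≤ a i) →
    _≐_ R I (ProdIdeals R (λ i → _^I_ R (m i) (a i))) →
    ∃ λ (G : Fin r → Graph c (c ⊔ ℓ) (c ⊔ ℓ)) →
      (∀ i → IsCompleteMultipartiteOver (G i) (Quot R (m i))) ×
      (UnitaryCayley R I ≅G Conj G)
corollary4p7 R _ I _ _ r m a m-max m-distinct 1≤a I≐Πmᵃ =
  (λ i → UnitaryCayley R (m i ^ a i)) ,
  (λ i → unitaryCayley-^-completeMultipartite (m-max i) (a i) (1≤a i)) ,
  unitaryCayley≅Conj I (λ i → m i ^ a i) pairwiseComaximal I≐Πmᵃ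
  where
  open CommutativeAlgebra R

  pairwiseComaximal : PairwiseComaximal (λ i → m i ^ a i)
  pairwiseComaximal i j i≢j =
    comaximal-^-^ (distinct-maximal⇒comaximal (m-max i) (m-max j) (m-distinct i j i≢j)) (a i) (a j)
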